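{- For each $i \geq 5$, $T_{i-3}$ only occurs at positions $1$, $\tau_{i-3} + \tau_{i-4} + 1$, $\tau_{i-2} + \tau_{i-3} + 1$, $\tau_{i-1} + \tau_{i-3} + 1$, and $\tau_{i-1} + \tau_{i-2} + 1$ in $T_{i}$.
   Context: Strings are over $\{\texttt{a},\texttt{b}\}$. For a binary string $S$, $\overline{S}$ is obtained by swapping \texttt{a} and \texttt{b}. The Thue-Morse word is $T_1 := \texttt{a}$, $T_i := T_{i-1}\overline{T_{i-1}}$ for $i\ge 2$, and $\tau_i := |T_i| = 2^{i-1}$. -}

module Defs where

open import Data.Nat using (ℕ; zero; suc; _+_; _∸_; _^_; _≤_)
open import Data.List using (List; []; _∷_; _++_; map; drop; length)
open import Data.Product using (_×_; ∃-syntax)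
open import Data.Sum using (_⊎_)
open import Relation.Binary.PropositionalEquality using (_≡_)

data Letter : Set where
  a b : Letter

Word : Set
Word = List Letter

flip : Letter → Letter
flip a = b
flip b = a

compl : Word → Word
compl = map flip

-- Thue–Morse prefixes, 1-indexed as in the paper: T 1 = a, T i = T (i-1) ++ compl (T (i-1)).
-- (T 0 is an unused dummy value.)
T : ℕ → Word
T zero = []
T (suc zero) = a ∷ []
T (suc (suc n)) = T (suc n) ++ compl (T (suc n))

-- τ_i = |T_i| = 2^(i-1).
τ : ℕ → ℕ
τ i = 2 ^ (i ∸ 1)

OccursAt : Word → Word → ℕ → Set
OccursAt P W p = 1 ≤ p × ∃[ X ] ∃[ Y ] (length X ≡ p ∸ 1 × W ≡ X ++ P ++ Y)

{-# OPTIONS --safe #-}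
-- T (k + 1) = μ (T k) for the Thue–Morse morphism μ : a ↦ ab, b ↦ ba.  In a
-- μ-image the letters at offsets 2j and 2j + 1 always differ, so a word starting
-- with abb (such as T (i - 3) for i ≥ 6) only occurs in μ (W) at even offsets,
-- and μ (P) occurs in μ (W) at offset 2k exactly when P occurs in W at offset k.
-- Hence the offsets of T (i - 3) in T i are those of T 2 = ab in
-- T 5 = abbabaabbaababba, namely 0, 3, 6, 10, 12, multiplied by 2 ^ (i - 5).
module Submission where

open import Defs
open import Data.Nat using (ℕ; zero; suc; _+_; _*_; _∸_; _^_; _≤_; s≤s; z≤n)
open import Data.Nat.Properties using (+-suc; *-identityʳ)
open import Data.Nat.Tactic.RingSolver using (solve-∀)
open import Data.List using (List; []; _∷_; _++_; drop; take; length)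
open import Data.List.Properties using (∷-injective; drop-[]; take++drop≡id)
open import Data.Sum using (_⊎_; inj₁; inj₂)
open import Data.Product using (_×_; _,_; proj₂; ∃-syntax)
open import Data.Empty using (⊥-elim)
open import Function.Bundles using (_⇔_; mk⇔; Equivalence)
open import Relation.Nullary using (¬_)
open import Relation.Binary.PropositionalEquality
  using (_≡_; _≢_; refl; sym; trans; cong; subst; subst₂; module ≡-Reasoning)

open Equivalence using (to; from)

drop-length-++ : ∀ {A : Set} (xs ys : List A) → drop (length xs) (xs ++ ys) ≡ ys
drop-length-++ []       ys = refl
drop-length-++ (x ∷ xs) ys = drop-length-++ xs ys

drop≡∷⇒length-take : ∀ {A : Set} q (xs : List A) {y : A} {ys : List A} →
                     drop q xs ≡ y ∷ ys → length (take q xs) ≡ q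
drop≡∷⇒length-take zero    xs       e = refl
drop≡∷⇒length-take (suc q) (x ∷ xs) e = cong suc (drop≡∷⇒length-take q xs e)

parity : ∀ q → ∃[ k ] (q ≡ k + k ⊎ q ≡ suc (k + k))
parity zero = 0 , inj₁ refl
parity (suc q) with parity q
... | k , inj₁ refl = k , inj₂ refl
... | k , inj₂ refl = suc k , inj₁ (cong suc (sym (+-suc k k)))

μ : Word → Word
μ []       = []
μ (x ∷ xs) = x ∷ flip x ∷ μ xs

μ-++ : ∀ xs ys → μ (xs ++ ys) ≡ μ xs ++ μ ys
μ-++ []       ys = refl
μ-++ (x ∷ xs) ys = cong (λ zs → x ∷ flip x ∷ zs) (μ-++ xs ys)

μ-compl : ∀ xs → μ (compl xs) ≡ compl (μ xs)
μ-compl []       = refl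
μ-compl (x ∷ xs) = cong (λ zs → flip x ∷ flip (flip x) ∷ zs) (μ-compl xs)

drop-μ : ∀ k W → drop (k + k) (μ W) ≡ μ (drop k W)
drop-μ zero    W       = refl
drop-μ (suc k) []      = refl
drop-μ (suc k) (x ∷ W) rewrite +-suc k k = drop-μ k W

μ-prefix : ∀ V U Z → μ V ≡ μ U ++ Z → ∃[ Y ] V ≡ U ++ Y
μ-prefix V       []      Z e = V , refl
μ-prefix (v ∷ V) (u ∷ U) Z e with ∷-injective e
... | refl , e′ with μ-prefix V U Z (proj₂ (∷-injective e′))
...   | Y , V≡U++Y = Y , cong (v ∷_) V≡U++Y

T-μ : ∀ n → T (2 + n) ≡ μ (T (1 + n))
T-μ zero    = refl
T-μ (suc n) = begin
  T (2 + n) ++ compl (T (2 + n))             ≡⟨ cong (λ W → W ++ compl W) (T-μ n) ⟩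
  μ (T (1 + n)) ++ compl (μ (T (1 + n)))     ≡⟨ cong (μ (T (1 + n)) ++_) (μ-compl (T (1 + n))) ⟨
  μ (T (1 + n)) ++ μ (compl (T (1 + n)))     ≡⟨ μ-++ (T (1 + n)) (compl (T (1 + n))) ⟨
  μ (T (2 + n))                              ∎
  where open ≡-Reasoning

T-ab : ∀ n → ∃[ R ] T (2 + n) ≡ a ∷ b ∷ R
T-ab zero = [] , refl
T-ab (suc n) with T-ab n
... | R , e = R ++ compl (T (2 + n)) , cong (_++ compl (T (2 + n))) e

T-abb : ∀ n → ∃[ R ] T (3 + n) ≡ a ∷ b ∷ b ∷ R
T-abb n with T-ab n
... | R , e = a ∷ μ R , trans (T-μ (1 + n)) (cong μ e)

OccursAt₀ : Word → Word → ℕ → Set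
OccursAt₀ P W q = ∃[ Y ] drop q W ≡ P ++ Y

occursAt⇒occursAt₀ : ∀ {P W q} → OccursAt P W (suc q) → OccursAt₀ P W q
occursAt⇒occursAt₀ {P} (_ , X , Y , refl , refl) = Y , drop-length-++ X (P ++ Y)

occursAt₀⇒occursAt : ∀ {P W q} → P ≢ [] → OccursAt₀ P W q → OccursAt P W (suc q)
occursAt₀⇒occursAt {[]}    P≢[] _ = ⊥-elim (P≢[] refl)
occursAt₀⇒occursAt {x ∷ P} {W} {q} _ (Y , e) =
  s≤s z≤n , take q W , Y , drop≡∷⇒length-take q W e ,
  trans (sym (take++drop≡id q W)) (cong (take q W ++_) e)

occursAt₀-μ-double : ∀ {P} W k → OccursAt₀ P W k → OccursAt₀ (μ P) (μ W) (k + k)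
occursAt₀-μ-double {P} W k (Y , e) = μ Y , (begin
  drop (k + k) (μ W)  ≡⟨ drop-μ k W ⟩
  μ (drop k W)        ≡⟨ cong μ e ⟩
  μ (P ++ Y)          ≡⟨ μ-++ P Y ⟩
  μ P ++ μ Y          ∎)
  where open ≡-Reasoning

occursAt₀-μ-halve : ∀ {P} W k → OccursAt₀ (μ P) (μ W) (k + k) → OccursAt₀ P W k
occursAt₀-μ-halve {P} W k (Z , e) =
  μ-prefix (drop k W) P Z (trans (sym (drop-μ k W)) e)

¬occursAt₀-square-μ-odd : ∀ k W {x y P} → ¬ OccursAt₀ (x ∷ y ∷ y ∷ P) (μ W) (suc (k + k))
¬occursAt₀-square-μ-odd zero    []            (_ , ())
¬occursAt₀-square-μ-odd zero    (_ ∷ [])      (_ , ())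
¬occursAt₀-square-μ-odd zero    (_ ∷ a ∷ _)   (_ , ())
¬occursAt₀-square-μ-odd zero    (_ ∷ b ∷ _)   (_ , ())
¬occursAt₀-square-μ-odd (suc k) []            (_ , ())
¬occursAt₀-square-μ-odd (suc k) (_ ∷ W) rewrite +-suc k k = ¬occursAt₀-square-μ-odd k W

data BaseOffset : ℕ → Set where
  offset₀  : BaseOffset 0
  offset₃  : BaseOffset 3
  offset₆  : BaseOffset 6
  offset₁₀ : BaseOffset 10
  offset₁₂ : BaseOffset 12

Offset : ℕ → ℕ → Set
Offset n q = ∃[ c ] BaseOffset c × q ≡ c * 2 ^ n

*-double : ∀ c m → c * (2 * m) ≡ c * m + c * m
*-double = solve-∀

offset-double : ∀ n {k} → Offset n k → Offset (suc n) (k + k)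
offset-double n (c , c∈ , refl) = c , c∈ , sym (*-double c (2 ^ n))

offset-halve : ∀ n {q} → Offset (suc n) q → ∃[ k ] q ≡ k + k × Offset n k
offset-halve n (c , c∈ , refl) = c * 2 ^ n , *-double c (2 ^ n) , c , c∈ , refl

T₂-in-T₅⇒baseOffset : ∀ q → OccursAt₀ (T 2) (T 5) q → BaseOffset q
T₂-in-T₅⇒baseOffset 0  _ = offset₀
T₂-in-T₅⇒baseOffset 1  (_ , ())
T₂-in-T₅⇒baseOffset 2  (_ , ())
T₂-in-T₅⇒baseOffset 3  _ = offset₃
T₂-in-T₅⇒baseOffset 4  (_ , ())
T₂-in-T₅⇒baseOffset 5  (_ , ())
T₂-in-T₅⇒baseOffset 6  _ = offset₆
T₂-in-T₅⇒baseOffset 7  (_ , ())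
T₂-in-T₅⇒baseOffset 8  (_ , ())
T₂-in-T₅⇒baseOffset 9  (_ , ())
T₂-in-T₅⇒baseOffset 10 _ = offset₁₀
T₂-in-T₅⇒baseOffset 11 (_ , ())
T₂-in-T₅⇒baseOffset 12 _ = offset₁₂
T₂-in-T₅⇒baseOffset 13 (_ , ())
T₂-in-T₅⇒baseOffset 14 (_ , ())
T₂-in-T₅⇒baseOffset 15 (_ , ())
T₂-in-T₅⇒baseOffset (suc (suc (suc (suc (suc (suc (suc (suc
                     (suc (suc (suc (suc (suc (suc (suc (suc q)))))))))))))))) (_ , e)
  with trans (sym (drop-[] q)) e
... | ()

baseOffset⇒T₂-in-T₅ : ∀ {c} → BaseOffset c → OccursAt₀ (T 2) (T 5) c
baseOffset⇒T₂-in-T₅ offset₀  = _ , refl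
baseOffset⇒T₂-in-T₅ offset₃  = _ , refl
baseOffset⇒T₂-in-T₅ offset₆  = _ , refl
baseOffset⇒T₂-in-T₅ offset₁₀ = _ , refl
baseOffset⇒T₂-in-T₅ offset₁₂ = _ , refl

T-occurrence⇒offset : ∀ n q → OccursAt₀ (T (2 + n)) (T (5 + n)) q → Offset n q
T-occurrence⇒offset zero    q occ = q , T₂-in-T₅⇒baseOffset q occ , sym (*-identityʳ q)
T-occurrence⇒offset (suc n) q occ with parity q
... | k , inj₁ refl = offset-double n (T-occurrence⇒offset n k (occursAt₀-μ-halve (T (5 + n)) k
        (subst₂ (λ P W → OccursAt₀ P W (k + k)) (T-μ (1 + n)) (T-μ (4 + n)) occ)))
... | k , inj₂ refl = ⊥-elim (¬occursAt₀-square-μ-odd k (T (5 + n))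
        (subst₂ (λ P W → OccursAt₀ P W (suc (k + k))) (proj₂ (T-abb n)) (T-μ (4 + n)) occ))

offset⇒T-occurrence : ∀ n q → Offset n q → OccursAt₀ (T (2 + n)) (T (5 + n)) q
offset⇒T-occurrence zero    _ (c , c∈ , refl) =
  subst (OccursAt₀ (T 2) (T 5)) (sym (*-identityʳ c)) (baseOffset⇒T₂-in-T₅ c∈)
offset⇒T-occurrence (suc n) q off with offset-halve n off
... | k , refl , off′ = subst₂ (λ P W → OccursAt₀ P W (k + k)) (sym (T-μ (1 + n))) (sym (T-μ (4 + n)))
                          (occursAt₀-μ-double (T (5 + n)) k (offset⇒T-occurrence n k off′))

ListedPositions : ℕ → ℕ → Set
ListedPositions i p =
  p ≡ 1
  ⊎ p ≡ τ (i ∸ 3) + τ (i ∸ 4) + 1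
  ⊎ p ≡ τ (i ∸ 2) + τ (i ∸ 3) + 1
  ⊎ p ≡ τ (i ∸ 1) + τ (i ∸ 3) + 1
  ⊎ p ≡ τ (i ∸ 1) + τ (i ∸ 2) + 1

listed⇔offset : ∀ n p → ListedPositions (5 + n) p ⇔ (∃[ c ] BaseOffset c × p ≡ suc (c * 2 ^ n))
listed⇔offset n p = mk⇔ listed⇒offset offset⇒listed
  where
  -- τ (5 + n ∸ j) reduces to 2 ^ (4 - j) * m as nested doublings of m.
  m = 2 ^ n
  sum₃ : ∀ x → 2 * x + x + 1 ≡ suc (3 * x)
  sum₃ = solve-∀
  sum₆ : ∀ x → 2 * (2 * x) + 2 * x + 1 ≡ suc (6 * x)
  sum₆ = solve-∀
  sum₁₀ : ∀ x → 2 * (2 * (2 * x)) + 2 * x + 1 ≡ suc (10 * x)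
  sum₁₀ = solve-∀
  sum₁₂ : ∀ x → 2 * (2 * (2 * x)) + 2 * (2 * x) + 1 ≡ suc (12 * x)
  sum₁₂ = solve-∀

  listed⇒offset : ListedPositions (5 + n) p → ∃[ c ] BaseOffset c × p ≡ suc (c * 2 ^ n)
  listed⇒offset (inj₁ refl)                        = 0 , offset₀ , refl
  listed⇒offset (inj₂ (inj₁ refl))                 = 3 , offset₃ , sum₃ m
  listed⇒offset (inj₂ (inj₂ (inj₁ refl)))          = 6 , offset₆ , sum₆ m
  listed⇒offset (inj₂ (inj₂ (inj₂ (inj₁ refl))))   = 10 , offset₁₀ , sum₁₀ m
  listed⇒offset (inj₂ (inj₂ (inj₂ (inj₂ refl))))   = 12 , offset₁₂ , sum₁₂ m

  offset⇒listed : ∃[ c ] BaseOffset c × p ≡ suc (c * 2 ^ n) → ListedPositions (5 + n) p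
  offset⇒listed (_ , offset₀  , refl) = inj₁ refl
  offset⇒listed (_ , offset₃  , refl) = inj₂ (inj₁ (sym (sum₃ m)))
  offset⇒listed (_ , offset₆  , refl) = inj₂ (inj₂ (inj₁ (sym (sum₆ m))))
  offset⇒listed (_ , offset₁₀ , refl) = inj₂ (inj₂ (inj₂ (inj₁ (sym (sum₁₀ m)))))
  offset⇒listed (_ , offset₁₂ , refl) = inj₂ (inj₂ (inj₂ (inj₂ (sym (sum₁₂ m)))))

corollary37 : ∀ (i p : ℕ) → 5 ≤ i →
  (OccursAt (T (i ∸ 3)) (T i) p →
     (p ≡ 1
      ⊎ p ≡ τ (i ∸ 3) + τ (i ∸ 4) + 1
      ⊎ p ≡ τ (i ∸ 2) + τ (i ∸ 3) + 1
      ⊎ p ≡ τ (i ∸ 1) + τ (i ∸ 3) + 1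
      ⊎ p ≡ τ (i ∸ 1) + τ (i ∸ 2) + 1))
  ×
  ((p ≡ 1
      ⊎ p ≡ τ (i ∸ 3) + τ (i ∸ 4) + 1
      ⊎ p ≡ τ (i ∸ 2) + τ (i ∸ 3) + 1
      ⊎ p ≡ τ (i ∸ 1) + τ (i ∸ 3) + 1
      ⊎ p ≡ τ (i ∸ 1) + τ (i ∸ 2) + 1) →
     OccursAt (T (i ∸ 3)) (T i) p)
corollary37 (suc (suc (suc (suc (suc n))))) p (s≤s (s≤s (s≤s (s≤s (s≤s z≤n))))) =
  occurs⇒listed p , listed⇒occurs
  where
  occurs⇒listed : ∀ p → OccursAt (T (2 + n)) (T (5 + n)) p → ListedPositions (5 + n) p
  occurs⇒listed zero    (() , _)
  occurs⇒listed (suc q) occ with T-occurrence⇒offset n q (occursAt⇒occursAt₀ occ)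
  ... | c , c∈ , refl = from (listed⇔offset n _) (c , c∈ , refl)

  T₂₊ₙ≢[] : T (2 + n) ≢ []
  T₂₊ₙ≢[] e with trans (sym (proj₂ (T-ab n))) e
  ... | ()

  listed⇒occurs : ListedPositions (5 + n) p → OccursAt (T (2 + n)) (T (5 + n)) p
  listed⇒occurs listed with to (listed⇔offset n p) listed
  ... | c , c∈ , refl = occursAt₀⇒occursAt T₂₊ₙ≢[] (offset⇒T-occurrence n _ (c , c∈ , refl))
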